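{- Consider an instance of Unlabeled Pebble Motion on Trees on a tree $T=(V,E)$ with root $r$, and let $d$ be the demand function of the initial configuration. Then every feasible plan has length at least $\sum_{u\in V}|d(u)|$.
   Context: Unlabeled Pebble Motion on Trees (UPMT): a tree $T=(V,E)$ with $n=|V|$ nodes; $k$ pebbles initially occupy $k$ distinct nodes; $k$ distinct nodes are designated as targets (targets may coincide with starting nodes). A move moves a single pebble from its current node to an adjacent node containing no pebble. A plan is a sequence of moves; it is feasible if after executing it every pebble is on a target node (so every target holds a pebble). The length of a plan is its number of moves. Fix an arbitrary root $r\in V$; $T_u$ is the subtree rooted at $u$. With $p(u)\in\{0,1\}$ the number of pebbles on $u$ and $\tau(u)\in\{0,1\}$ the number of targets at $u$, the demand is $d(u)=\sum_{v\in T_u}\tau(v)-\sum_{v\in T_u}p(v)$. -}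

module Defs where

open import Data.Nat using (ℕ; zero; suc; _≤_)
open import Data.Integer using (ℤ; _-_; ∣_∣; +_)
open import Data.Fin using (Fin)
open import Data.Fin.Subset using (Subset; _∈_; _∉_; inside; outside)
open import Data.Vec using (_[_]≔_)
open import Data.Bool using (Bool; true; false)
open import Data.List using (List; []; _∷_; length; map; allFin)
open import Data.Nat.ListAction using (sum)
open import Data.List.Relation.Unary.Unique.Propositional using (Unique)
import Data.List.Membership.Propositional as LM
open import Data.Product using (_×_; ∃; ∃-syntax; _,_)
open import Relation.Nullary using (¬_)
open import Relation.Binary.PropositionalEquality using (_≡_)

-- A (simple, undirected) graph on the vertex set Fin n is given by an
-- adjacency relation E; "symmetric and irreflexive" is imposed in IsTree.

data Walk {n : ℕ} (E : Fin n → Fin n → Set) : Fin n → Fin n → List (Fin n) → Set where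
  here : ∀ {x} → Walk E x x (x ∷ [])
  step : ∀ {x y z vs} → E x y → Walk E y z vs → Walk E x z (x ∷ vs)

Path : {n : ℕ} → (Fin n → Fin n → Set) → Fin n → Fin n → List (Fin n) → Set
Path E x y vs = Walk E x y vs × Unique vs

Connected : {n : ℕ} → (Fin n → Fin n → Set) → Set
Connected E = ∀ x y → ∃[ vs ] Walk E x y vs

HasCycle : {n : ℕ} → (Fin n → Fin n → Set) → Set
HasCycle E = ∃[ x ] ∃[ y ] ∃[ vs ] (Path E x y vs × (3 ≤ length vs) × E y x)

record IsTree {n : ℕ} (E : Fin n → Fin n → Set) : Set where
  field
    sym     : ∀ {x y} → E x y → E y x
    irrefl  : ∀ {x} → ¬ E x x
    connected : Connected E
    acyclic : ¬ HasCycle E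

-- v ∈ T_u (tree rooted at r): u lies on the (unique) r–v path.
InSubtree : {n : ℕ} → (Fin n → Fin n → Set) → (r u v : Fin n) → Set
InSubtree E r u v = ∃[ vs ] (Path E r v vs × u LM.∈ vs)

SubtreeIndicator : {n : ℕ} → (Fin n → Fin n → Set) → Fin n → (Fin n → Fin n → Bool) → Set
SubtreeIndicator E r χ = ∀ u v → (χ u v ≡ true → InSubtree E r u v) × (InSubtree E r u v → χ u v ≡ true)

-- Configurations of unlabeled pebbles: the set of occupied nodes.
-- A move (u , v): the pebble on u goes to the adjacent, unoccupied node v.
data Exec {n : ℕ} (E : Fin n → Fin n → Set) : Subset n → List (Fin n × Fin n) → Subset n → Set where
  done : ∀ {C} → Exec E C [] C
  move : ∀ {C D u v ms} → E u v → u ∈ C → v ∉ C →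
         Exec E ((C [ u ]≔ outside) [ v ]≔ inside) ms D → Exec E C ((u , v) ∷ ms) D

Feasible : {n : ℕ} → (Fin n → Fin n → Set) → Subset n → Subset n → List (Fin n × Fin n) → Set
Feasible {n} E P τ ms = ∃[ D ] (Exec E P ms D × (∀ (v : Fin n) → v ∈ D → v ∈ τ))

[_] : Bool → ℕ
[ true ] = 1
[ false ] = 0

countIn : {n : ℕ} → (Fin n → Fin n → Bool) → Fin n → Subset n → ℕ
countIn {n} χ u S = sum (map (λ v → [ χ u v Data.Bool.∧ Data.Vec.lookup S v ]) (allFin n))
  where import Data.Bool; import Data.Vec

demand : {n : ℕ} → (Fin n → Fin n → Bool) → Subset n → Subset n → Fin n → ℤ
demand χ P τ u = + countIn χ u τ - + countIn χ u P

totalAbsDemand : {n : ℕ} → (Fin n → Fin n → Bool) → Subset n → Subset n → ℕ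
totalAbsDemand {n} χ P τ = sum (map (λ u → ∣ demand χ P τ u ∣) (allFin n))

-- For a node w and a configuration C let Φ_w(C) be the number of pebbles of C in T_w, so that
-- d(w) = Φ_w(τ) − Φ_w(P). Moving a pebble along an edge u v changes Φ_w only when exactly one of
-- u, v lies in T_w, which happens for a single w (the lower endpoint of the edge, as a tree has no
-- cycles), and then by one. Hence Σ_w |Φ_w(C) − Φ_w(D)| drops by at most one per move. Moves keep
-- the number of pebbles, so the final configuration of a feasible plan, being contained in the
-- target set and of the same size, is the target set; the potential thus falls from Σ_w |d(w)| to 0.
module Submission where

open import Defs
open import Data.Bool using (Bool; true; false; _∧_) renaming (_≟_ to _≟ᵇ_)
open import Data.Bool.Properties using (∧-identityʳ; ∧-zeroʳ; ¬-not)
open import Data.Empty using (⊥)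
open import Data.Fin using (Fin; punchIn; _≟_)
open import Data.Fin.Properties using (punchInᵢ≢i)
open import Data.Fin.Subset using (Subset; ∣_∣; _∈_; _∉_; _⊆_; inside; outside)
open import Data.Fin.Subset.Properties using (_∈?_; ⊆-antisym; p⊂q⇒∣p∣<∣q∣)
import Data.Integer as ℤ
open import Data.Integer using (_⊖_)
open import Data.Integer.Properties using (m-n≡m⊖n; ∣⊖∣-≤; ∣m⊖n∣≡∣n⊖m∣)
open import Data.List using (List; []; _∷_; _++_; _∷ʳ_; length; map; allFin; tabulate)
open import Data.List.Properties using (map-tabulate; ++-assoc)
open import Data.List.Membership.Propositional using () renaming (_∈_ to _∈ₗ_; _∉_ to _∉ₗ_)
open import Data.List.Membership.Propositional.Properties using (∈-++⁺ˡ; ∈-++⁻)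
open import Data.List.Relation.Unary.All using ([]; _∷_)
import Data.List.Relation.Unary.All.Properties as All
open import Data.List.Relation.Unary.AllPairs using ([]; _∷_)
open import Data.List.Relation.Unary.Any using (here; there)
open import Data.List.Relation.Unary.Unique.Propositional using (Unique)
import Data.List.Relation.Unary.Unique.Propositional.Properties as Unique
open import Data.Nat using (ℕ; zero; suc; _+_; _∸_; _≤_; z≤n; s≤s; ∣_-_∣)
import Data.Nat.ListAction as List
open import Data.Nat.Properties hiding (_≟_)
open import Data.Product using (_×_; ∃-syntax; ∃₂; _,_; proj₁; proj₂)
open import Data.Sum using (_⊎_; inj₁; inj₂)
open import Data.Vec using ([]; _∷_; lookup; _[_]≔_)
open import Data.Vec.Properties using (lookup∘update; lookup∘update′; []=⇒lookup; lookup⇒[]=)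
open import Relation.Binary.PropositionalEquality
  using (_≡_; _≢_; refl; sym; trans; cong; cong₂; subst; module ≡-Reasoning)
open import Relation.Nullary using (¬_; yes; no; contradiction)
open import Relation.Nullary.Decidable using (decidable-stable)
open import Algebra.Properties.CommutativeMonoid.Sum +-0-commutativeMonoid
  using (sum; sum-syntax; sum-remove; sum-cong-≗; sum-replicate-zero)
open import Algebra.Properties.CommutativeSemigroup +-commutativeSemigroup using (xy∙z≈zy∙x; xy∙z≈xz∙y)

m+p≡n+o⇒∣m-n∣≡∣o-p∣ : ∀ m n o p → m + p ≡ n + o → ∣ m - n ∣ ≡ ∣ o - p ∣
m+p≡n+o⇒∣m-n∣≡∣o-p∣ m n o p eq = begin
  ∣ m - n ∣         ≡⟨ ∣m+n-m+o∣≡∣n-o∣ p m n ⟨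
  ∣ p + m - p + n ∣ ≡⟨ cong₂ ∣_-_∣ (trans (+-comm p m) eq) (+-comm p n) ⟩
  ∣ n + o - n + p ∣ ≡⟨ ∣m+n-m+o∣≡∣n-o∣ n o p ⟩
  ∣ o - p ∣         ∎
  where open ≡-Reasoning

∣[x]-[y]∣≤1 : ∀ x y → ∣ [ x ] - [ y ] ∣ ≤ 1
∣[x]-[y]∣≤1 true  true  = z≤n
∣[x]-[y]∣≤1 true  false = s≤s z≤n
∣[x]-[y]∣≤1 false true  = s≤s z≤n
∣[x]-[y]∣≤1 false false = z≤n

∣+m-+n∣≡∣m-n∣ : ∀ m n → ℤ.∣ ℤ.+ m ℤ.- ℤ.+ n ∣ ≡ ∣ m - n ∣
∣+m-+n∣≡∣m-n∣ m n rewrite m-n≡m⊖n m n with ≤-total m n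
... | inj₁ m≤n = trans (∣⊖∣-≤ m≤n) (sym (m≤n⇒∣m-n∣≡n∸m m≤n))
... | inj₂ n≤m = begin
  ℤ.∣ m ⊖ n ∣ ≡⟨ ∣m⊖n∣≡∣n⊖m∣ m n ⟩
  ℤ.∣ n ⊖ m ∣ ≡⟨ ∣⊖∣-≤ n≤m ⟩
  m ∸ n       ≡⟨ m≤n⇒∣m-n∣≡n∸m n≤m ⟨
  ∣ n - m ∣   ≡⟨ ∣-∣-comm n m ⟩
  ∣ m - n ∣   ∎
  where open ≡-Reasoning

List-sum-map-allFin : ∀ {n} (f : Fin n → ℕ) → List.sum (map f (allFin n)) ≡ sum f
List-sum-map-allFin f = trans (cong List.sum (map-tabulate (λ i → i) f)) (List-sum-tabulate f)
  where
  List-sum-tabulate : ∀ {n} (f : Fin n → ℕ) → List.sum (tabulate f) ≡ sum f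
  List-sum-tabulate {zero}  f = refl
  List-sum-tabulate {suc n} f = cong (f Fin.zero +_) (List-sum-tabulate (λ i → f (Fin.suc i)))

∑-mono-≤ : ∀ {n} {f g : Fin n → ℕ} → (∀ i → f i ≤ g i) → sum f ≤ sum g
∑-mono-≤ {zero}  f≤g = z≤n
∑-mono-≤ {suc n} f≤g = +-mono-≤ (f≤g Fin.zero) (∑-mono-≤ (λ i → f≤g (Fin.suc i)))

∑-≤-suc : ∀ {n} {f g : Fin n → ℕ} (c : Fin n) → (∀ i → i ≢ c → f i ≤ g i) → f c ≤ suc (g c) →
          sum f ≤ suc (sum g)
∑-≤-suc {suc n} {f} {g} c f≤g fc≤ = begin
  sum f                                   ≡⟨ sum-remove f ⟩
  f c + sum (λ j → f (punchIn c j))       ≤⟨ +-mono-≤ fc≤ (∑-mono-≤ (λ j → f≤g _ (punchInᵢ≢i c j))) ⟩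
  suc (g c + sum (λ j → g (punchIn c j))) ≡⟨ cong suc (sum-remove g) ⟨
  suc (sum g)                             ∎
  where open ≤-Reasoning

p⊆q⇒∣p∣≡∣q∣⇒p≡q : ∀ {n} {p q : Subset n} → p ⊆ q → ∣ p ∣ ≡ ∣ q ∣ → p ≡ q
p⊆q⇒∣p∣≡∣q∣⇒p≡q {p = p} {q} p⊆q ∣p∣≡∣q∣ = ⊆-antisym p⊆q q⊆p
  where
  q⊆p : q ⊆ p
  q⊆p {x} x∈q with x ∈? p
  ... | yes x∈p = x∈p
  ... | no x∉p  = contradiction ∣p∣≡∣q∣ (<⇒≢ (p⊂q⇒∣p∣<∣q∣ (p⊆q , x , x∈q , x∉p)))

count : ∀ {n} → (Fin n → Bool) → Subset n → ℕ
count {n} f C = ∑[ v < n ] [ f v ∧ lookup C v ]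

countIn≡count : ∀ {n} (χ : Fin n → Fin n → Bool) u S → countIn χ u S ≡ count (χ u) S
countIn≡count χ u S = List-sum-map-allFin (λ v → [ χ u v ∧ lookup S v ])

∣-∣≡count : ∀ {n} (C : Subset n) → ∣ C ∣ ≡ count (λ _ → true) C
∣-∣≡count []          = refl
∣-∣≡count (true ∷ C)  = cong suc (∣-∣≡count C)
∣-∣≡count (false ∷ C) = ∣-∣≡count C

count-update : ∀ {n} f (C : Subset n) i b →
               count f (C [ i ]≔ b) + [ f i ∧ lookup C i ] ≡ count f C + [ f i ∧ b ]
count-update {suc n} f C i b = begin
  count f C′ + old             ≡⟨ cong (_+ old) (sum-remove {i = i} (term C′)) ⟩
  term C′ i + rest C′ + old    ≡⟨ cong (λ x → [ f i ∧ x ] + rest C′ + old) (lookup∘update i C b) ⟩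
  new + rest C′ + old          ≡⟨ cong (λ x → new + x + old) (sum-cong-≗ unchanged) ⟩
  new + rest C + old           ≡⟨ xy∙z≈zy∙x new (rest C) old ⟩
  old + rest C + new           ≡⟨ cong (_+ new) (sum-remove {i = i} (term C)) ⟨
  count f C + new              ∎
  where
  open ≡-Reasoning
  C′ = C [ i ]≔ b
  old = [ f i ∧ lookup C i ]
  new = [ f i ∧ b ]
  term : Subset (suc n) → Fin (suc n) → ℕ
  term D v = [ f v ∧ lookup D v ]
  rest : Subset (suc n) → ℕ
  rest D = sum (λ j → term D (punchIn i j))
  unchanged : ∀ j → term C′ (punchIn i j) ≡ term C (punchIn i j)
  unchanged j = cong (λ x → [ f (punchIn i j) ∧ x ]) (lookup∘update′ (punchInᵢ≢i i j) C b)

count-insert : ∀ {n} f (C : Subset n) v → lookup C v ≡ false →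
               count f (C [ v ]≔ inside) ≡ count f C + [ f v ]
count-insert f C v Cv≡false with count-update f C v inside
... | eq rewrite Cv≡false | ∧-zeroʳ (f v) | ∧-identityʳ (f v) | +-identityʳ (count f (C [ v ]≔ inside)) = eq

count-remove : ∀ {n} f (C : Subset n) u → lookup C u ≡ true →
               count f (C [ u ]≔ outside) + [ f u ] ≡ count f C
count-remove f C u Cu≡true with count-update f C u outside
... | eq rewrite Cu≡true | ∧-zeroʳ (f u) | ∧-identityʳ (f u) | +-identityʳ (count f C) = eq

∉⇒lookup≡false : ∀ {n} {C : Subset n} {v} → v ∉ C → lookup C v ≡ false
∉⇒lookup≡false {C = C} {v} v∉C = ¬-not (λ Cv≡true → v∉C (lookup⇒[]= v C Cv≡true))

count-move : ∀ {n} f (C : Subset n) {u v} → u ∈ C → v ∉ C →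
             count f ((C [ u ]≔ outside) [ v ]≔ inside) + [ f u ] ≡ count f C + [ f v ]
count-move f C {u} {v} u∈C v∉C = begin
  count f (C₁ [ v ]≔ inside) + [ f u ] ≡⟨ cong (_+ [ f u ]) (count-insert f C₁ v v∉C₁) ⟩
  count f C₁ + [ f v ] + [ f u ]       ≡⟨ xy∙z≈xz∙y (count f C₁) [ f v ] [ f u ] ⟩
  count f C₁ + [ f u ] + [ f v ]       ≡⟨ cong (_+ [ f v ]) (count-remove f C u ([]=⇒lookup u∈C)) ⟩
  count f C + [ f v ]                  ∎
  where
  open ≡-Reasoning
  C₁ = C [ u ]≔ outside
  v∉C₁ : lookup C₁ v ≡ false
  v∉C₁ = trans (lookup∘update′ (λ { refl → v∉C u∈C }) C outside) (∉⇒lookup≡false v∉C)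

count-move-≡ : ∀ {n} f (C : Subset n) {u v} → u ∈ C → v ∉ C → f u ≡ f v →
               count f ((C [ u ]≔ outside) [ v ]≔ inside) ≡ count f C
count-move-≡ f C {u} {v} u∈C v∉C fu≡fv =
  +-cancelʳ-≡ [ f v ] (count f C′) (count f C)
    (subst (λ b → count f C′ + [ b ] ≡ count f C + [ f v ]) fu≡fv (count-move f C u∈C v∉C))
  where C′ = (C [ u ]≔ outside) [ v ]≔ inside

count-move-∣-∣≤1 : ∀ {n} f (C : Subset n) {u v} → u ∈ C → v ∉ C →
                   ∣ count f C - count f ((C [ u ]≔ outside) [ v ]≔ inside) ∣ ≤ 1
count-move-∣-∣≤1 f C {u} {v} u∈C v∉C = begin
  ∣ count f C - count f C′ ∣ ≡⟨ m+p≡n+o⇒∣m-n∣≡∣o-p∣ (count f C) (count f C′) [ f u ] [ f v ] moved ⟩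
  ∣ [ f u ] - [ f v ] ∣      ≤⟨ ∣[x]-[y]∣≤1 (f u) (f v) ⟩
  1                          ∎
  where
  open ≤-Reasoning
  C′ = (C [ u ]≔ outside) [ v ]≔ inside
  moved : count f C + [ f v ] ≡ count f C′ + [ f u ]
  moved = sym (count-move f C u∈C v∉C)

Exec-preserves-∣-∣ : ∀ {n} {E : Fin n → Fin n → Set} {C ms D} → Exec E C ms D → ∣ D ∣ ≡ ∣ C ∣
Exec-preserves-∣-∣ done = refl
Exec-preserves-∣-∣ {C = C} {D = D} (move {u = u} {v} _ u∈C v∉C ex) = begin
  ∣ D ∣                   ≡⟨ Exec-preserves-∣-∣ ex ⟩
  ∣ C′ ∣                  ≡⟨ ∣-∣≡count C′ ⟩
  count (λ _ → true) C′   ≡⟨ count-move-≡ (λ _ → true) C u∈C v∉C refl ⟩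
  count (λ _ → true) C    ≡⟨ ∣-∣≡count C ⟨
  ∣ C ∣                   ∎
  where
  open ≡-Reasoning
  C′ = (C [ u ]≔ outside) [ v ]≔ inside

Unique-++⁻ : ∀ {a} {A : Set a} (xs : List A) {ys} → Unique (xs ++ ys) → Unique xs × Unique ys
Unique-++⁻ []       ys!          = [] , ys!
Unique-++⁻ (x ∷ xs) (x∉ ∷ xsys!) with Unique-++⁻ xs xsys!
... | xs! , ys! = All.++⁻ˡ xs x∉ ∷ xs! , ys!

module _ {n} {E : Fin n → Fin n → Set} where

  Walk-∷ʳ : ∀ {x u v ps} → Walk E x u ps → E u v → Walk E x v (ps ∷ʳ v)
  Walk-∷ʳ here          e = step e here
  Walk-∷ʳ (step e′ xu) e = step e′ (Walk-∷ʳ xu e)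

  Path-∷ʳ : ∀ {x u v ps} → Path E x u ps → E u v → v ∉ₗ ps → Path E x v (ps ∷ʳ v)
  Path-∷ʳ (xu , ps!) e v∉ps = Walk-∷ʳ xu e , Unique.++⁺ ps! ([] ∷ []) λ { (v∈ps , here refl) → v∉ps v∈ps }

  Walk-split : ∀ {x y v ps} → Walk E x y ps → v ∈ₗ ps →
               ∃₂ λ as bs → ps ≡ as ++ v ∷ bs × Walk E x v (as ∷ʳ v) × Walk E v y (v ∷ bs)
  Walk-split here        (here refl) = [] , [] , refl , here , here
  Walk-split (step e xy) (here refl) = [] , _ , refl , here , step e xy
  Walk-split {x} (step e xy) (there v∈) with Walk-split xy v∈
  ... | as , bs , refl , yv , vz = x ∷ as , bs , refl , step e yv , vz

  Path-split : ∀ {x y v ps} → Path E x y ps → v ∈ₗ ps →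
               ∃₂ λ as bs → Path E x v (as ∷ʳ v) × Path E v y (v ∷ bs)
                          × (∀ {w} → w ∈ₗ ps → w ∈ₗ as ∷ʳ v ⊎ w ∈ₗ bs)
  Path-split {v = v} (xy , ps!) v∈ with Walk-split xy v∈
  ... | as , bs , refl , xv , vy =
    as , bs , (xv , proj₁ (Unique-++⁻ (as ∷ʳ v) (subst Unique ps≡ ps!))) , (vy , proj₂ (Unique-++⁻ as ps!)) ,
    λ w∈ → ∈-++⁻ (as ∷ʳ v) (subst (_ ∈ₗ_) ps≡ w∈)
    where ps≡ = sym (++-assoc as (v ∷ []) bs)

subtreeGap : ∀ {n} → (Fin n → Fin n → Bool) → Subset n → Subset n → ℕ
subtreeGap {n} χ C D = ∑[ w < n ] ∣ count (χ w) C - count (χ w) D ∣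

module _ {n} {E : Fin n → Fin n → Set} (tree : IsTree E) (r : Fin n) where
  open IsTree tree using (irrefl; acyclic) renaming (sym to E-sym)
  open import Data.List.Membership.DecPropositional (_≟_ {n}) using () renaming (_∈?_ to _∈ₗ?_)

  Path-to-neighbour : ∀ {u v vs} → Path E v u vs → E u v → vs ≡ v ∷ u ∷ []
  Path-to-neighbour (here , _)           e = contradiction e irrefl
  Path-to-neighbour (step _ here , _)    e = refl
  Path-to-neighbour {vs = _ ∷ _ ∷ _ ∷ _} vu e = contradiction (_ , _ , _ , vu , s≤s (s≤s (s≤s z≤n)) , e) acyclic

  InSubtree-∷ʳ : ∀ {u v w ps} → Path E r u ps → E u v → v ∉ₗ ps → w ∈ₗ ps → InSubtree E r w v
  InSubtree-∷ʳ ru e v∉ps w∈ps = _ , Path-∷ʳ ru e v∉ps , ∈-++⁺ˡ w∈ps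

  -- If v lies on the path from r to u, it is the vertex just before u: otherwise the rest of
  -- the path closes a cycle with the edge u v.
  InSubtree-edge : ∀ {u v w} → E u v → InSubtree E r w u → ¬ InSubtree E r w v → w ≡ u
  InSubtree-edge {u} {v} e (ps , ru , w∈ps) w∉Tv with v ∈ₗ? ps
  ... | no v∉ps = contradiction (InSubtree-∷ʳ ru e v∉ps w∈ps) w∉Tv
  ... | yes v∈ps with Path-split ru v∈ps
  ... | as , bs , rv , vu , cover with cover w∈ps
  ...   | inj₁ w∈rv = contradiction (_ , rv , w∈rv) w∉Tv
  ...   | inj₂ w∈bs with Path-to-neighbour vu e
  ...     | refl with w∈bs
  ...       | here w≡u = w≡u

  edge-nested : ∀ {u v} → E u v → InSubtree E r u u → InSubtree E r v u ⊎ InSubtree E r u v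
  edge-nested {v = v} e (ps , ru , u∈ps) with v ∈ₗ? ps
  ... | yes v∈ps = inj₁ (ps , ru , v∈ps)
  ... | no v∉ps  = inj₂ (InSubtree-∷ʳ ru e v∉ps u∈ps)

  module _ {χ : Fin n → Fin n → Bool} (χ-spec : SubtreeIndicator E r χ) where

    χ-true⇒InSubtree : ∀ {w x} → χ w x ≡ true → InSubtree E r w x
    χ-true⇒InSubtree = proj₁ (χ-spec _ _)

    χ-false⇒¬InSubtree : ∀ {w x} → χ w x ≡ false → ¬ InSubtree E r w x
    χ-false⇒¬InSubtree χ≡false wTx with trans (sym χ≡false) (proj₂ (χ-spec _ _) wTx)
    ... | ()

    χ-differs : ∀ {w u v} → χ w u ≢ χ w v →
                (InSubtree E r w u × ¬ InSubtree E r w v) ⊎ (InSubtree E r w v × ¬ InSubtree E r w u)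
    χ-differs {w} {u} {v} χu≢χv with χ w u in χu | χ w v in χv
    ... | true  | true  = contradiction refl χu≢χv
    ... | false | false = contradiction refl χu≢χv
    ... | true  | false = inj₁ (χ-true⇒InSubtree χu , χ-false⇒¬InSubtree χv)
    ... | false | true  = inj₂ (χ-true⇒InSubtree χv , χ-false⇒¬InSubtree χu)

    χ-differs⇒endpoint : ∀ {w u v} → E u v → χ w u ≢ χ w v → w ≡ u ⊎ w ≡ v
    χ-differs⇒endpoint e χu≢χv with χ-differs χu≢χv
    ... | inj₁ (wTu , w∉Tv) = inj₁ (InSubtree-edge e wTu w∉Tv)
    ... | inj₂ (wTv , w∉Tu) = inj₂ (InSubtree-edge (E-sym e) wTv w∉Tu)

    χ-differs-at-tail : ∀ {u v} → E u v → χ u u ≢ χ u v → InSubtree E r u u × ¬ InSubtree E r u v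
    χ-differs-at-tail e χu≢χv with χ-differs χu≢χv
    ... | inj₁ uTu,u∉Tv = uTu,u∉Tv
    ... | inj₂ (uTv , u∉Tu) = contradiction (InSubtree-edge (E-sym e) uTv u∉Tu) λ { refl → irrefl e }

    χ-differs-at-one-end : ∀ {u v} → E u v → χ u u ≢ χ u v → χ v u ≢ χ v v → ⊥
    χ-differs-at-one-end e χuu≢χuv χvu≢χvv
      with χ-differs-at-tail e χuu≢χuv | χ-differs-at-tail (E-sym e) (λ eq → χvu≢χvv (sym eq))
    ... | uTu , u∉Tv | vTv , v∉Tu with edge-nested e uTu
    ...   | inj₁ vTu = v∉Tu vTu
    ...   | inj₂ uTv = u∉Tv uTv

    edge-crosses-one-subtree : ∀ {u v} → E u v → ∃[ c ] ∀ w → w ≢ c → χ w u ≡ χ w v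
    edge-crosses-one-subtree {u} {v} e with χ u u ≟ᵇ χ u v
    ... | yes χuu≡χuv = v , λ w w≢v → decidable-stable (χ w u ≟ᵇ χ w v) (not-u w≢v)
      where
      not-u : ∀ {w} → w ≢ v → ¬ χ w u ≢ χ w v
      not-u w≢v χu≢χv with χ-differs⇒endpoint e χu≢χv
      ... | inj₁ refl = χu≢χv χuu≡χuv
      ... | inj₂ w≡v  = w≢v w≡v
    ... | no χuu≢χuv  = u , λ w w≢u → decidable-stable (χ w u ≟ᵇ χ w v) (not-v w≢u)
      where
      not-v : ∀ {w} → w ≢ u → ¬ χ w u ≢ χ w v
      not-v w≢u χu≢χv with χ-differs⇒endpoint e χu≢χv
      ... | inj₁ w≡u  = w≢u w≡u
      ... | inj₂ refl = χ-differs-at-one-end e χuu≢χuv χu≢χv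

    subtreeGap-Exec : ∀ {C ms D} → Exec E C ms D → subtreeGap χ C D ≤ length ms
    subtreeGap-Exec {C} done =
      ≤-reflexive (trans (sum-cong-≗ (λ w → ∣n-n∣≡0 (count (χ w) C))) (sum-replicate-zero n))
    subtreeGap-Exec {C} {D = D} (move {u = u} {v} e u∈C v∉C ex) with edge-crosses-one-subtree e
    ... | c , χ-same = ≤-trans (∑-≤-suc c unchanged crossed) (s≤s (subtreeGap-Exec ex))
      where
      C′ = (C [ u ]≔ outside) [ v ]≔ inside
      unchanged : ∀ w → w ≢ c → ∣ count (χ w) C - count (χ w) D ∣ ≤ ∣ count (χ w) C′ - count (χ w) D ∣
      unchanged w w≢c =
        ≤-reflexive (cong (λ k → ∣ k - count (χ w) D ∣) (sym (count-move-≡ (χ w) C u∈C v∉C (χ-same w w≢c))))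
      crossed : ∣ count (χ c) C - count (χ c) D ∣ ≤ suc ∣ count (χ c) C′ - count (χ c) D ∣
      crossed = ≤-trans (∣-∣-triangle (count (χ c) C) (count (χ c) C′) (count (χ c) D))
                        (+-monoˡ-≤ _ (count-move-∣-∣≤1 (χ c) C u∈C v∉C))

totalAbsDemand≡subtreeGap : ∀ {n} (χ : Fin n → Fin n → Bool) P τ → totalAbsDemand χ P τ ≡ subtreeGap χ P τ
totalAbsDemand≡subtreeGap χ P τ =
  trans (List-sum-map-allFin (λ u → ℤ.∣ demand χ P τ u ∣)) (sum-cong-≗ ∣demand∣≡gap)
  where
  ∣demand∣≡gap : ∀ u → ℤ.∣ demand χ P τ u ∣ ≡ ∣ count (χ u) P - count (χ u) τ ∣
  ∣demand∣≡gap u = begin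
    ℤ.∣ demand χ P τ u ∣                  ≡⟨ ∣+m-+n∣≡∣m-n∣ (countIn χ u τ) (countIn χ u P) ⟩
    ∣ countIn χ u τ - countIn χ u P ∣     ≡⟨ cong₂ ∣_-_∣ (countIn≡count χ u τ) (countIn≡count χ u P) ⟩
    ∣ count (χ u) τ - count (χ u) P ∣     ≡⟨ ∣-∣-comm (count (χ u) τ) (count (χ u) P) ⟩
    ∣ count (χ u) P - count (χ u) τ ∣     ∎
    where open ≡-Reasoning

mainTheorem2 : (n : ℕ) (E : Fin n → Fin n → Set) → IsTree E → (r : Fin n)
    → (χ : Fin n → Fin n → Bool) → SubtreeIndicator E r χ
    → (k : ℕ) (P τ : Subset n) → ∣ P ∣ ≡ k → ∣ τ ∣ ≡ k
    → (ms : List (Fin n × Fin n)) → Feasible E P τ ms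
    → totalAbsDemand χ P τ ≤ length ms
mainTheorem2 n E tree r χ χ-spec k P τ ∣P∣≡k ∣τ∣≡k ms (D , exec , D⊆τ) = begin
  totalAbsDemand χ P τ ≡⟨ totalAbsDemand≡subtreeGap χ P τ ⟩
  subtreeGap χ P τ     ≡⟨ cong (subtreeGap χ P) D≡τ ⟨
  subtreeGap χ P D     ≤⟨ subtreeGap-Exec tree r χ-spec exec ⟩
  length ms            ∎
  where
  open ≤-Reasoning
  D≡τ : D ≡ τ
  D≡τ = p⊆q⇒∣p∣≡∣q∣⇒p≡q (λ {v} → D⊆τ v) (trans (Exec-preserves-∣-∣ exec) (trans ∣P∣≡k (sym ∣τ∣≡k)))
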